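{- Let $I=\{1,\ldots,n\}$ and let $\mathrm{p}:2^I\to\{+1,-1,0\}$ be an oriented even $\Delta$-matroid, i.e. a map satisfying: (1) $\mathrm{p}$ is not identically zero; (2) for all $A,B\subseteq I$ with $\mathrm{p}(A)\neq 0$ and $\mathrm{p}(B)\neq 0$ we have $\#A\equiv \#B \pmod 2$; (3) if $A,B\subseteq I$ with $A\,\Delta\, B=\{i_1<\cdots<i_l\}$ and for some $w\in\{+1,-1\}$ the numbers $\kappa_j = w(-1)^j\,\mathrm{p}(A\,\Delta\,\{i_j\})\cdot \mathrm{p}(B\,\Delta\,\{i_j\})$ satisfy $\kappa_j\ge 0$ for all $1\le j\le l$, then $\kappa_j=0$ for all $1\le j\le l$. Then the collection of bases $\mathcal{B}=\{F\subseteq I : \mathrm{p}(F)\neq 0\}$ is a $\Delta$-matroid, i.e. for all $E,F\in\mathcal{B}$ and every $e\in E\,\Delta\, F$ there exists $f\in E\,\Delta\, F$ such that $E\,\Delta\,\{e,f\}\in\mathcal{B}$.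
   Context: $A\,\Delta\, B=(A\cup B)\setminus(A\cap B)$ denotes symmetric difference. An oriented even $\Delta$-matroid is usually considered up to the equivalence $\mathrm{p}\sim-\mathrm{p}$, which does not affect the set of bases. -}

module Defs where

open import Data.Nat using (ℕ; _≤_; _%_)
open import Data.Fin using (Fin; toℕ)
open import Data.Fin.Subset using (Subset; _∪_; _∩_; _─_; _∈_; ⁅_⁆; ∣_∣)
open import Data.Vec using (Vec; tabulate; lookup)
open import Data.Bool using (Bool; true; false; _∧_)
open import Data.Integer using (ℤ; +_; -_; _*_; _≥_; 1ℤ; -1ℤ; 0ℤ)
open import Data.Product using (Σ; ∃; _×_)
open import Data.Sum using (_⊎_)
open import Relation.Nullary using (¬_; does)
open import Relation.Binary.PropositionalEquality using (_≡_)
open import Data.Nat.Properties using (_≤?_)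

_Δ_ : ∀ {n} → Subset n → Subset n → Subset n
A Δ B = (A ∪ B) ─ (A ∩ B)

infixl 6 _Δ_

pair : ∀ {n} → Fin n → Fin n → Subset n
pair e f = ⁅ e ⁆ ∪ ⁅ f ⁆

atMost : ∀ {n} → Subset n → Fin n → Subset n
atMost {n} S i = tabulate λ k → lookup S k ∧ does (toℕ k ≤? toℕ i)

-- position j of i in the increasing enumeration S = {i_1 < ... < i_l}
-- (1-based: j = #{k ∈ S : k ≤ i}); meaningful for i ∈ S
position : ∀ {n} → Subset n → Fin n → ℕ
position S i = ∣ atMost S i ∣

sgnPow : ℕ → ℤ
sgnPow j with j % 2
... | 0 = 1ℤ
... | _ = -1ℤ

IsSign : ℤ → Set
IsSign x = (x ≡ 1ℤ) ⊎ (x ≡ -1ℤ) ⊎ (x ≡ 0ℤ)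

-- κ_j for the element i = i_j of A Δ B
κ : ∀ {n} → (Subset n → ℤ) → ℤ → Subset n → Subset n → Fin n → ℤ
κ p w A B i = w * sgnPow (position (A Δ B) i) * p (A Δ ⁅ i ⁆) * p (B Δ ⁅ i ⁆)

record OrientedEvenΔMatroid (n : ℕ) (p : Subset n → ℤ) : Set where
  field
    signValued : ∀ A → IsSign (p A)
    nonzero    : ∃ λ A → ¬ (p A ≡ 0ℤ)
    even       : ∀ A B → ¬ (p A ≡ 0ℤ) → ¬ (p B ≡ 0ℤ) → ∣ A ∣ % 2 ≡ ∣ B ∣ % 2
    exchange   : ∀ A B (w : ℤ) → (w ≡ 1ℤ ⊎ w ≡ -1ℤ) →
                 (∀ i → i ∈ A Δ B → κ p w A B i ≥ 0ℤ) →
                 ∀ i → i ∈ A Δ B → κ p w A B i ≡ 0ℤ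

IsBasis : ∀ {n} → (Subset n → ℤ) → Subset n → Set
IsBasis p F = ¬ (p F ≡ 0ℤ)

IsΔMatroid : ∀ {n} → (Subset n → Set) → Set
IsΔMatroid {n} 𝓑 = ∀ E F → 𝓑 E → 𝓑 F → ∀ e → e ∈ E Δ F →
  ∃ λ f → f ∈ E Δ F × 𝓑 (E Δ pair e f)

-- Put A = E Δ {e} and B = F Δ {e}; then A Δ B = E Δ F, and A Δ {e} = E, B Δ {e} = F are bases.
-- Choose the sign w so that κ_e = 1. If no f ≠ e in E Δ F made E Δ {e, f} = A Δ {f} a basis,
-- every other κ_f would vanish, so all κ_j ≥ 0 while κ_e ≠ 0, against axiom (3).
module Submission where

open import Defs
open import Data.Nat using (ℕ; zero; suc; z≤n; _%_)
open import Data.Integer using (ℤ; 1ℤ; -1ℤ; 0ℤ; _*_; _≥_; +≤+)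
import Data.Integer.Properties as ℤ
open import Data.Bool using (true; false; _xor_)
open import Data.Bool.Properties using (xor-assoc; xor-comm; xor-same)
open import Data.Fin using (Fin)
import Data.Fin.Properties as Fin
open import Data.Fin.Subset using (Subset; ⊥; ⁅_⁆; _∪_; _∩_; _─_; _∈_)
open import Data.Fin.Subset.Properties
  using (_∈?_; Empty-unique; x∈p∩q⁻; x∈⁅y⁆⇒x≡y; p─⊥≡p)
open import Data.Vec using ([]; _∷_; zipWith; map)
open import Data.Vec.Properties
  using (zipWith-assoc; zipWith-comm; zipWith-identityˡ; zipWith-inverseʳ; map-id)
open import Function using (id)
open import Data.Product using (∃; _×_; _,_)
open import Data.Sum using (_⊎_; inj₁; inj₂)
open import Data.Empty using (⊥-elim)
open import Relation.Nullary using (yes; no)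
open import Relation.Nullary.Decidable using (_×-dec_; ¬?)
open import Relation.Binary.PropositionalEquality
  using (_≡_; _≢_; refl; sym; trans; cong; subst; ≢-sym; module ≡-Reasoning)
open ≡-Reasoning

private
  variable
    n : ℕ

Δ-is-xor : (X Y : Subset n) → X Δ Y ≡ zipWith _xor_ X Y
Δ-is-xor []          []          = refl
Δ-is-xor (true  ∷ X) (true  ∷ Y) = cong (false ∷_) (Δ-is-xor X Y)
Δ-is-xor (true  ∷ X) (false ∷ Y) = cong (true  ∷_) (Δ-is-xor X Y)
Δ-is-xor (false ∷ X) (true  ∷ Y) = cong (true  ∷_) (Δ-is-xor X Y)
Δ-is-xor (false ∷ X) (false ∷ Y) = cong (false ∷_) (Δ-is-xor X Y)

Δ-assoc : (X Y Z : Subset n) → (X Δ Y) Δ Z ≡ X Δ (Y Δ Z)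
Δ-assoc X Y Z = begin
  (X Δ Y) Δ Z                           ≡⟨ Δ-is-xor (X Δ Y) Z ⟩
  zipWith _xor_ (X Δ Y) Z               ≡⟨ cong (λ V → zipWith _xor_ V Z) (Δ-is-xor X Y) ⟩
  zipWith _xor_ (zipWith _xor_ X Y) Z   ≡⟨ zipWith-assoc xor-assoc X Y Z ⟩
  zipWith _xor_ X (zipWith _xor_ Y Z)   ≡⟨ cong (zipWith _xor_ X) (Δ-is-xor Y Z) ⟨
  zipWith _xor_ X (Y Δ Z)               ≡⟨ Δ-is-xor X (Y Δ Z) ⟨
  X Δ (Y Δ Z)                           ∎

Δ-comm : (X Y : Subset n) → X Δ Y ≡ Y Δ X
Δ-comm X Y = begin
  X Δ Y               ≡⟨ Δ-is-xor X Y ⟩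
  zipWith _xor_ X Y   ≡⟨ zipWith-comm xor-comm X Y ⟩
  zipWith _xor_ Y X   ≡⟨ Δ-is-xor Y X ⟨
  Y Δ X               ∎

Δ-identityˡ : (X : Subset n) → ⊥ Δ X ≡ X
Δ-identityˡ X = trans (Δ-is-xor ⊥ X) (zipWith-identityˡ (λ _ → refl) X)

Δ-identityʳ : (X : Subset n) → X Δ ⊥ ≡ X
Δ-identityʳ X = trans (Δ-comm X ⊥) (Δ-identityˡ X)

Δ-same : (X : Subset n) → X Δ X ≡ ⊥
Δ-same X = begin
  X Δ X                         ≡⟨ Δ-is-xor X X ⟩
  zipWith _xor_ X X             ≡⟨ cong (zipWith _xor_ X) (map-id X) ⟨
  zipWith _xor_ X (map id X)    ≡⟨ zipWith-inverseʳ xor-same X ⟩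
  ⊥                             ∎

Δ-cancelʳ : (X Z : Subset n) → (X Δ Z) Δ Z ≡ X
Δ-cancelʳ X Z = begin
  (X Δ Z) Δ Z   ≡⟨ Δ-assoc X Z Z ⟩
  X Δ (Z Δ Z)   ≡⟨ cong (X Δ_) (Δ-same Z) ⟩
  X Δ ⊥         ≡⟨ Δ-identityʳ X ⟩
  X             ∎

Δ-cancel-common : (X Y Z : Subset n) → (X Δ Z) Δ (Y Δ Z) ≡ X Δ Y
Δ-cancel-common X Y Z = begin
  (X Δ Z) Δ (Y Δ Z)   ≡⟨ Δ-assoc X Z (Y Δ Z) ⟩
  X Δ (Z Δ (Y Δ Z))   ≡⟨ cong (λ V → X Δ (Z Δ V)) (Δ-comm Y Z) ⟩
  X Δ (Z Δ (Z Δ Y))   ≡⟨ cong (X Δ_) (Δ-assoc Z Z Y) ⟨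
  X Δ ((Z Δ Z) Δ Y)   ≡⟨ cong (λ V → X Δ (V Δ Y)) (Δ-same Z) ⟩
  X Δ (⊥ Δ Y)         ≡⟨ cong (X Δ_) (Δ-identityˡ Y) ⟩
  X Δ Y               ∎

disjoint⇒Δ≡∪ : (X Y : Subset n) → X ∩ Y ≡ ⊥ → X Δ Y ≡ X ∪ Y
disjoint⇒Δ≡∪ X Y X∩Y≡⊥ = trans (cong ((X ∪ Y) ─_) X∩Y≡⊥) (p─⊥≡p (X ∪ Y))

x≢y⇒⁅x⁆∩⁅y⁆≡⊥ : {x y : Fin n} → x ≢ y → ⁅ x ⁆ ∩ ⁅ y ⁆ ≡ ⊥
x≢y⇒⁅x⁆∩⁅y⁆≡⊥ {x = x} {y} x≢y = Empty-unique λ where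
  (z , z∈⁅x⁆∩⁅y⁆) → let z∈⁅x⁆ , z∈⁅y⁆ = x∈p∩q⁻ ⁅ x ⁆ ⁅ y ⁆ z∈⁅x⁆∩⁅y⁆ in
    x≢y (trans (sym (x∈⁅y⁆⇒x≡y x z∈⁅x⁆)) (x∈⁅y⁆⇒x≡y y z∈⁅y⁆))

Δ⁅⁆-Δ⁅⁆≡Δ-pair : (X : Subset n) {e f : Fin n} → e ≢ f → (X Δ ⁅ e ⁆) Δ ⁅ f ⁆ ≡ X Δ pair e f
Δ⁅⁆-Δ⁅⁆≡Δ-pair X {e} {f} e≢f =
  trans (Δ-assoc X ⁅ e ⁆ ⁅ f ⁆) (cong (X Δ_) (disjoint⇒Δ≡∪ ⁅ e ⁆ ⁅ f ⁆ (x≢y⇒⁅x⁆∩⁅y⁆≡⊥ e≢f)))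

IsUnit : ℤ → Set
IsUnit x = x ≡ 1ℤ ⊎ x ≡ -1ℤ

sgnPow-unit : ∀ j → IsUnit (sgnPow j)
sgnPow-unit j with j % 2
... | zero  = inj₁ refl
... | suc _ = inj₂ refl

nonzero-sign-unit : ∀ {x} → IsSign x → x ≢ 0ℤ → IsUnit x
nonzero-sign-unit (inj₁ x≡1)        _   = inj₁ x≡1
nonzero-sign-unit (inj₂ (inj₁ x≡-1)) _   = inj₂ x≡-1
nonzero-sign-unit (inj₂ (inj₂ x≡0))  x≢0 = ⊥-elim (x≢0 x≡0)

unit-* : ∀ {x y} → IsUnit x → IsUnit y → IsUnit (x * y)
unit-* (inj₁ refl) (inj₁ refl) = inj₁ refl
unit-* (inj₁ refl) (inj₂ refl) = inj₂ refl
unit-* (inj₂ refl) (inj₁ refl) = inj₂ refl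
unit-* (inj₂ refl) (inj₂ refl) = inj₁ refl

unit-square : ∀ {x} → IsUnit x → x * x ≡ 1ℤ
unit-square (inj₁ refl) = refl
unit-square (inj₂ refl) = refl

κ-weight : (Subset n → ℤ) → Subset n → Subset n → Fin n → ℤ
κ-weight p A B i = sgnPow (position (A Δ B) i) * p (A Δ ⁅ i ⁆) * p (B Δ ⁅ i ⁆)

κ-at-own-weight : (p : Subset n → ℤ) (A B : Subset n) (i : Fin n) →
                  κ p (κ-weight p A B i) A B i ≡ κ-weight p A B i * κ-weight p A B i
κ-at-own-weight p A B i = begin
  w * s * a * b       ≡⟨ cong (_* b) (ℤ.*-assoc w s a) ⟩
  w * (s * a) * b     ≡⟨ ℤ.*-assoc w (s * a) b ⟩
  w * (s * a * b)     ∎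
  where
  s = sgnPow (position (A Δ B) i)
  a = p (A Δ ⁅ i ⁆)
  b = p (B Δ ⁅ i ⁆)
  w = κ-weight p A B i

κ-vanishes : (p : Subset n → ℤ) (w : ℤ) (A B : Subset n) (i : Fin n) →
             p (A Δ ⁅ i ⁆) ≡ 0ℤ → κ p w A B i ≡ 0ℤ
κ-vanishes p w A B i pA≡0 = begin
  w * s * p (A Δ ⁅ i ⁆) * b   ≡⟨ cong (λ a → w * s * a * b) pA≡0 ⟩
  w * s * 0ℤ * b              ≡⟨ cong (_* b) (ℤ.*-zeroʳ (w * s)) ⟩
  0ℤ * b                      ≡⟨ ℤ.*-zeroˡ b ⟩
  0ℤ                          ∎
  where
  s = sgnPow (position (A Δ B) i)
  b = p (B Δ ⁅ i ⁆)

module _ {p : Subset n → ℤ} (M : OrientedEvenΔMatroid n p) where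
  open OrientedEvenΔMatroid M

  basis-unit : ∀ {A} → IsBasis p A → IsUnit (p A)
  basis-unit = nonzero-sign-unit (signValued _)

  exchange-partner : ∀ A B e → e ∈ A Δ B → IsBasis p (A Δ ⁅ e ⁆) → IsBasis p (B Δ ⁅ e ⁆) →
                     ∃ λ f → f ∈ A Δ B × f ≢ e × IsBasis p (A Δ ⁅ f ⁆)
  exchange-partner A B e e∈AΔB A⁅e⁆-basis B⁅e⁆-basis
    with Fin.any? (λ f → f ∈? A Δ B ×-dec ¬? (f Fin.≟ e) ×-dec ¬? (p (A Δ ⁅ f ⁆) ℤ.≟ 0ℤ))
  ... | yes partner   = partner
  ... | no no-partner = ⊥-elim (1≢0 (trans (sym κe≡1) (exchange A B w w-unit κ≥0 e e∈AΔB)))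
    where
    w : ℤ
    w = κ-weight p A B e

    w-unit : IsUnit w
    w-unit = unit-* (unit-* (sgnPow-unit (position (A Δ B) e)) (basis-unit A⁅e⁆-basis))
                    (basis-unit B⁅e⁆-basis)

    κe≡1 : κ p w A B e ≡ 1ℤ
    κe≡1 = trans (κ-at-own-weight p A B e) (unit-square w-unit)

    κ≥0 : ∀ i → i ∈ A Δ B → κ p w A B i ≥ 0ℤ
    κ≥0 i i∈AΔB with i Fin.≟ e | p (A Δ ⁅ i ⁆) ℤ.≟ 0ℤ
    ... | yes refl | _         = subst (_≥ 0ℤ) (sym κe≡1) (+≤+ z≤n)
    ... | no i≢e   | yes pAi≡0 = subst (_≥ 0ℤ) (sym (κ-vanishes p w A B i pAi≡0)) (+≤+ z≤n)
    ... | no i≢e   | no pAi≢0  = ⊥-elim (no-partner (i , i∈AΔB , i≢e , pAi≢0))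

    1≢0 : 1ℤ ≢ 0ℤ
    1≢0 ()

mainTheorem1 : (n : ℕ) (p : Subset n → ℤ) → OrientedEvenΔMatroid n p →
    IsΔMatroid (IsBasis p)
mainTheorem1 n p M E F E-basis F-basis e e∈EΔF =
  let f , f∈AΔB , f≢e , A⁅f⁆-basis = exchange-partner M A B e e∈AΔB A⁅e⁆-basis B⁅e⁆-basis
  in f , subst (f ∈_) AΔB≡EΔF f∈AΔB , subst (IsBasis p) (Δ⁅⁆-Δ⁅⁆≡Δ-pair E (≢-sym f≢e)) A⁅f⁆-basis
  where
  A B : Subset n
  A = E Δ ⁅ e ⁆
  B = F Δ ⁅ e ⁆

  AΔB≡EΔF : A Δ B ≡ E Δ F
  AΔB≡EΔF = Δ-cancel-common E F ⁅ e ⁆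

  e∈AΔB : e ∈ A Δ B
  e∈AΔB = subst (e ∈_) (sym AΔB≡EΔF) e∈EΔF

  A⁅e⁆-basis : IsBasis p (A Δ ⁅ e ⁆)
  A⁅e⁆-basis = subst (IsBasis p) (sym (Δ-cancelʳ E ⁅ e ⁆)) E-basis

  B⁅e⁆-basis : IsBasis p (B Δ ⁅ e ⁆)
  B⁅e⁆-basis = subst (IsBasis p) (sym (Δ-cancelʳ F ⁅ e ⁆)) F-basis
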